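{- Let $\mathbf A\in\mathcal S$ satisfy $0\to(x\to x)\approx x\to x$. Then $\mathbf A$ satisfies $(x\to x)\to(y\to z)\approx((x\to x)\to y)\to z$.
   Context: A zroupoid is an algebra $\langle A,\to,0\rangle$ with $\to$ binary and $0$ a constant; write $x' := x\to 0$. An implication zroupoid ($\mathcal I$-zroupoid) is a zroupoid satisfying (I) $(x\to y)\to z \approx ((z'\to x)\to(y\to z)')'$ and (I$_0$) $0''\approx 0$. $\mathcal S$ is the variety of $\mathcal I$-zroupoids satisfying $x''\approx x$ and $(x\to y')'\approx (y\to x')'$. -}

module Defs where

open import Level using (Level; suc)
open import Relation.Binary.PropositionalEquality using (_≡_)

record Zroupoid (a : Level) : Set (suc a) where
  field
    Carrier : Set a
    _⇒_     : Carrier → Carrier → Carrier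
    𝟎       : Carrier
  infixr 5 _⇒_

  _′ : Carrier → Carrier
  x ′ = x ⇒ 𝟎
  infix 6 _′

module _ {a : Level} (Z : Zroupoid a) where
  open Zroupoid Z

  IdentityI : Set a
  IdentityI = ∀ x y z → (x ⇒ y) ⇒ z ≡ (((z ′) ⇒ x) ⇒ ((y ⇒ z) ′)) ′

  IdentityI₀ : Set a
  IdentityI₀ = (𝟎 ′) ′ ≡ 𝟎

  record IsIZroupoid : Set a where
    field
      I  : IdentityI
      I₀ : IdentityI₀

  record InS : Set a where
    field
      isIZroupoid : IsIZroupoid
      involution  : ∀ x → (x ′) ′ ≡ x
      sym′        : ∀ x y → (x ⇒ (y ′)) ′ ≡ (y ⇒ (x ′)) ′

module Submission where

open import Defs
open import Level using (Level; suc)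
open import Relation.Binary.PropositionalEquality
  using (_≡_; sym; trans; cong; cong₂; module ≡-Reasoning)

-- In a zroupoid of 𝒮 put  x ∧ y := (x → y′)′  and  ¬ x := x′.
-- Then ∧ is commutative, ¬ is an involution, 𝟙 := 𝟎′ is a unit for ∧, and
-- identity (I) yields that ∧ distributes over the De Morgan dual
-- x ∨ y := ¬ (¬ x ∧ ¬ y); moreover  x → y = ¬ (x ∧ ¬ y).  We call such
-- structures De Morgan groupoids; associativity of ∧ is not assumed.
--
-- Writing 𝟙[ x ] := 𝟙 ∨ x ("the unit of x"), we derive
-- idempotence and absorption laws, then the behaviour of meets with 𝟘, and
-- finally the restricted associativity  (𝟙[ x ] ∧ y) ∧ z = 𝟙[ x ] ∧ (y ∧ z).
-- For e = a ∧ ¬ a satisfying 𝟘 ∧ e = e one has ¬ e = 𝟙[ e ] and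
-- e ∨ b = 𝟙[ e ] ∧ b, so associativity for 𝟙[ e ] yields
-- ¬ e ∧ (b ∧ c) = (e ∨ b) ∧ c.  Since x → x = ¬ (x ∧ ¬ x) and the
-- hypothesis 0 → (x → x) = x → x says 𝟘 ∧ e = e, translating back through
-- x → y = ¬ (x ∧ ¬ y) gives the theorem.

record DeMorganGroupoid (a : Level) : Set (suc a) where
  infix 8 ¬_
  infix 7 _∧_
  infix 6 _∨_
  field
    Carrier : Set a
    _∧_     : Carrier → Carrier → Carrier
    ¬_      : Carrier → Carrier
    𝟘       : Carrier

  _∨_ : Carrier → Carrier → Carrier
  x ∨ y = ¬ (¬ x ∧ ¬ y)

  𝟙 : Carrier
  𝟙 = ¬ 𝟘

  field
    ¬-involutive : ∀ x → ¬ ¬ x ≡ x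
    ∧-comm       : ∀ x y → x ∧ y ≡ y ∧ x
    ∧-identityʳ  : ∀ x → x ∧ 𝟙 ≡ x
    ∧-distribʳ-∨ : ∀ x y z → (x ∨ y) ∧ z ≡ x ∧ z ∨ y ∧ z

  -- The unit of x.  Intuition: in a Płonka sum of Boolean algebras 𝟙[ x ] is
  -- the top of the summand containing x, and x ∧ 𝟘 is its bottom.
  𝟙[_] : Carrier → Carrier
  𝟙[ x ] = 𝟙 ∨ x

module DeMorganGroupoidProperties {a : Level} (D : DeMorganGroupoid a) where
  open DeMorganGroupoid D
  open ≡-Reasoning

  ¬-injective : ∀ {x y} → ¬ x ≡ ¬ y → x ≡ y
  ¬-injective {x} {y} p = trans (sym (¬-involutive x)) (trans (cong ¬_ p) (¬-involutive y))

  ¬-∧ : ∀ x y → ¬ (x ∧ y) ≡ ¬ x ∨ ¬ y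
  ¬-∧ x y = cong ¬_ (sym (cong₂ _∧_ (¬-involutive x) (¬-involutive y)))

  ¬-∨ : ∀ x y → ¬ (x ∨ y) ≡ ¬ x ∧ ¬ y
  ¬-∨ x y = ¬-involutive (¬ x ∧ ¬ y)

  ¬𝟙 : ¬ 𝟙 ≡ 𝟘
  ¬𝟙 = ¬-involutive 𝟘

  ∨-comm : ∀ x y → x ∨ y ≡ y ∨ x
  ∨-comm x y = cong ¬_ (∧-comm (¬ x) (¬ y))

  ∧-identityˡ : ∀ x → 𝟙 ∧ x ≡ x
  ∧-identityˡ x = trans (∧-comm 𝟙 x) (∧-identityʳ x)

  ∨-identityʳ : ∀ x → x ∨ 𝟘 ≡ x
  ∨-identityʳ x = trans (cong ¬_ (∧-identityʳ (¬ x))) (¬-involutive x)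

  ∨-identityˡ : ∀ x → 𝟘 ∨ x ≡ x
  ∨-identityˡ x = trans (∨-comm 𝟘 x) (∨-identityʳ x)

  ∨-distribʳ-∧ : ∀ x y z → x ∧ y ∨ z ≡ (x ∨ z) ∧ (y ∨ z)
  ∨-distribʳ-∧ x y z = begin
    ¬ (¬ (x ∧ y) ∧ ¬ z)             ≡⟨ cong (λ w → ¬ (w ∧ ¬ z)) (¬-∧ x y) ⟩
    ¬ ((¬ x ∨ ¬ y) ∧ ¬ z)           ≡⟨ cong ¬_ (∧-distribʳ-∨ (¬ x) (¬ y) (¬ z)) ⟩
    ¬ (¬ x ∧ ¬ z ∨ ¬ y ∧ ¬ z)       ≡⟨ ¬-∨ (¬ x ∧ ¬ z) (¬ y ∧ ¬ z) ⟩
    (x ∨ z) ∧ (y ∨ z)               ∎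

  ∧∨-unit : ∀ x y → x ∧ y ∨ y ≡ 𝟙[ x ] ∧ y
  ∧∨-unit x y = begin
    x ∧ y ∨ y          ≡⟨ ∨-comm (x ∧ y) y ⟩
    y ∨ x ∧ y          ≡⟨ cong (_∨ x ∧ y) (sym (∧-identityˡ y)) ⟩
    𝟙 ∧ y ∨ x ∧ y      ≡⟨ sym (∧-distribʳ-∨ 𝟙 x y) ⟩
    𝟙[ x ] ∧ y         ∎

  𝟘∧𝟘 : 𝟘 ∧ 𝟘 ≡ 𝟘
  𝟘∧𝟘 = begin
    𝟘 ∧ 𝟘              ≡⟨ sym (∨-identityʳ (𝟘 ∧ 𝟘)) ⟩
    𝟘 ∧ 𝟘 ∨ 𝟘          ≡⟨ ∧∨-unit 𝟘 𝟘 ⟩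
    𝟙[ 𝟘 ] ∧ 𝟘         ≡⟨ cong (_∧ 𝟘) (∨-identityʳ 𝟙) ⟩
    𝟙 ∧ 𝟘              ≡⟨ ∧-identityˡ 𝟘 ⟩
    𝟘                  ∎

  𝟙∨𝟙 : 𝟙 ∨ 𝟙 ≡ 𝟙
  𝟙∨𝟙 = cong ¬_ (trans (cong₂ _∧_ ¬𝟙 ¬𝟙) 𝟘∧𝟘)

  ∨-idem : ∀ x → x ∨ x ≡ x
  ∨-idem x = begin
    x ∨ x              ≡⟨ cong (_∨ x) (sym (∧-identityˡ x)) ⟩
    𝟙 ∧ x ∨ x          ≡⟨ ∧∨-unit 𝟙 x ⟩
    𝟙[ 𝟙 ] ∧ x         ≡⟨ cong (_∧ x) 𝟙∨𝟙 ⟩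
    𝟙 ∧ x              ≡⟨ ∧-identityˡ x ⟩
    x                  ∎

  ∧-idem : ∀ x → x ∧ x ≡ x
  ∧-idem x = ¬-injective (trans (¬-∧ x x) (∨-idem (¬ x)))

  ∨∧-unit : ∀ x y → (x ∨ y) ∧ y ≡ 𝟙[ x ] ∧ y
  ∨∧-unit x y = begin
    (x ∨ y) ∧ y        ≡⟨ ∧-distribʳ-∨ x y y ⟩
    x ∧ y ∨ y ∧ y      ≡⟨ cong (x ∧ y ∨_) (∧-idem y) ⟩
    x ∧ y ∨ y          ≡⟨ ∧∨-unit x y ⟩
    𝟙[ x ] ∧ y         ∎

  ¬-∧𝟘 : ∀ x → ¬ (x ∧ 𝟘) ≡ 𝟙[ ¬ x ]
  ¬-∧𝟘 x = trans (¬-∧ x 𝟘) (∨-comm (¬ x) 𝟙)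

  ∧𝟘∨-unit : ∀ x y → x ∧ 𝟘 ∨ y ≡ 𝟙[ x ] ∧ y
  ∧𝟘∨-unit x y = begin
    ¬ (¬ (x ∧ 𝟘) ∧ ¬ y)        ≡⟨ cong (λ w → ¬ (w ∧ ¬ y)) (¬-∧𝟘 x) ⟩
    ¬ (𝟙[ ¬ x ] ∧ ¬ y)         ≡⟨ cong ¬_ (sym (∧∨-unit (¬ x) (¬ y))) ⟩
    ¬ (¬ x ∧ ¬ y ∨ ¬ y)        ≡⟨ ¬-∨ (¬ x ∧ ¬ y) (¬ y) ⟩
    (x ∨ y) ∧ ¬ ¬ y            ≡⟨ cong ((x ∨ y) ∧_) (¬-involutive y) ⟩
    (x ∨ y) ∧ y                ≡⟨ ∨∧-unit x y ⟩
    𝟙[ x ] ∧ y                 ∎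

  unit-∧-absorb : ∀ x y → 𝟙[ y ] ∧ (x ∧ y) ≡ x ∧ y
  unit-∧-absorb x y = begin
    𝟙[ y ] ∧ (x ∧ y)           ≡⟨ sym (∧𝟘∨-unit y (x ∧ y)) ⟩
    y ∧ 𝟘 ∨ x ∧ y              ≡⟨ cong (_∨ x ∧ y) (∧-comm y 𝟘) ⟩
    𝟘 ∧ y ∨ x ∧ y              ≡⟨ sym (∧-distribʳ-∨ 𝟘 x y) ⟩
    (𝟘 ∨ x) ∧ y                ≡⟨ cong (_∧ y) (∨-identityˡ x) ⟩
    x ∧ y                      ∎

  ∧-unit-absorb : ∀ x y → (𝟙[ y ] ∧ x) ∧ y ≡ x ∧ y
  ∧-unit-absorb x y = begin
    (𝟙[ y ] ∧ x) ∧ y           ≡⟨ cong (_∧ y) (sym (∧∨-unit y x)) ⟩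
    (y ∧ x ∨ x) ∧ y            ≡⟨ ∧-distribʳ-∨ (y ∧ x) x y ⟩
    (y ∧ x) ∧ y ∨ x ∧ y        ≡⟨ cong (_∨ x ∧ y) (trans (∧-comm (y ∧ x) y) (cong (y ∧_) (∧-comm y x))) ⟩
    y ∧ (x ∧ y) ∨ x ∧ y        ≡⟨ ∧∨-unit y (x ∧ y) ⟩
    𝟙[ y ] ∧ (x ∧ y)           ≡⟨ unit-∧-absorb x y ⟩
    x ∧ y                      ∎

  unit-∨-absorb : ∀ x y → 𝟙[ x ] ∧ y ∨ x ≡ x ∨ y
  unit-∨-absorb x y = begin
    𝟙[ x ] ∧ y ∨ x                 ≡⟨ cong (_∨ x) (sym (∧𝟘∨-unit x y)) ⟩
    ¬ (¬ (x ∧ 𝟘 ∨ y) ∧ ¬ x)        ≡⟨ cong (λ w → ¬ (w ∧ ¬ x)) (¬-∨ (x ∧ 𝟘) y) ⟩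
    ¬ ((¬ (x ∧ 𝟘) ∧ ¬ y) ∧ ¬ x)    ≡⟨ cong (λ w → ¬ ((w ∧ ¬ y) ∧ ¬ x)) (¬-∧𝟘 x) ⟩
    ¬ ((𝟙[ ¬ x ] ∧ ¬ y) ∧ ¬ x)     ≡⟨ cong ¬_ (∧-unit-absorb (¬ y) (¬ x)) ⟩
    y ∨ x                          ≡⟨ ∨-comm y x ⟩
    x ∨ y                          ∎

  unit-∧𝟘 : ∀ x y → 𝟙[ x ] ∧ (y ∧ 𝟘) ≡ (x ∨ y) ∧ 𝟘
  unit-∧𝟘 x y = trans (sym (∧𝟘∨-unit x (y ∧ 𝟘))) (sym (∧-distribʳ-∨ x y 𝟘))

  unit-∨-restrict : ∀ x y → 𝟙[ y ∨ x ] ∧ y ≡ 𝟙[ x ] ∧ y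
  unit-∨-restrict x y = begin
    𝟙[ y ∨ x ] ∧ y             ≡⟨ sym (∧𝟘∨-unit (y ∨ x) y) ⟩
    (y ∨ x) ∧ 𝟘 ∨ y            ≡⟨ cong (_∨ y) (sym (unit-∧𝟘 y x)) ⟩
    𝟙[ y ] ∧ (x ∧ 𝟘) ∨ y       ≡⟨ unit-∨-absorb y (x ∧ 𝟘) ⟩
    y ∨ x ∧ 𝟘                  ≡⟨ ∨-comm y (x ∧ 𝟘) ⟩
    x ∧ 𝟘 ∨ y                  ≡⟨ ∧𝟘∨-unit x y ⟩
    𝟙[ x ] ∧ y                 ∎

  ∨-absorbʳ : ∀ x y → (x ∨ y) ∨ y ≡ x ∨ y
  ∨-absorbʳ x y = begin
    (x ∨ y) ∨ y                ≡⟨ cong (_∨ y) (∨-comm x y) ⟩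
    (y ∨ x) ∨ y                ≡⟨ sym (unit-∨-absorb (y ∨ x) y) ⟩
    𝟙[ y ∨ x ] ∧ y ∨ (y ∨ x)   ≡⟨ cong (_∨ (y ∨ x)) (unit-∨-restrict x y) ⟩
    𝟙[ x ] ∧ y ∨ (y ∨ x)       ≡⟨ cong (_∨ (y ∨ x)) (sym (∨∧-unit x y)) ⟩
    (x ∨ y) ∧ y ∨ (y ∨ x)      ≡⟨ cong (λ w → w ∨ (y ∨ x)) (trans (∧-comm (x ∨ y) y) (cong (y ∧_) (∨-comm x y))) ⟩
    y ∧ (y ∨ x) ∨ (y ∨ x)      ≡⟨ ∧∨-unit y (y ∨ x) ⟩
    𝟙[ y ] ∧ (y ∨ x)           ≡⟨ cong (𝟙[ y ] ∧_) (∨-comm y x) ⟩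
    (𝟙 ∨ y) ∧ (x ∨ y)          ≡⟨ sym (∨-distribʳ-∧ 𝟙 x y) ⟩
    𝟙 ∧ x ∨ y                  ≡⟨ cong (_∨ y) (∧-identityˡ x) ⟩
    x ∨ y                      ∎

  ∧-absorbʳ : ∀ x y → (x ∧ y) ∧ y ≡ x ∧ y
  ∧-absorbʳ x y = ¬-injective (begin
    ¬ ((x ∧ y) ∧ y)            ≡⟨ ¬-∧ (x ∧ y) y ⟩
    ¬ (x ∧ y) ∨ ¬ y            ≡⟨ cong (_∨ ¬ y) (¬-∧ x y) ⟩
    (¬ x ∨ ¬ y) ∨ ¬ y          ≡⟨ ∨-absorbʳ (¬ x) (¬ y) ⟩
    ¬ x ∨ ¬ y                  ≡⟨ sym (¬-∧ x y) ⟩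
    ¬ (x ∧ y)                  ∎)

  -- Meets with 𝟘 only see the summand of their argument (see 𝟙[_]); in
  -- particular they cannot distinguish x ∧ y from x ∨ y.

  ∧∨-absorb : ∀ x y z → (x ∧ y ∨ z) ∧ y ≡ (x ∨ z) ∧ y
  ∧∨-absorb x y z = begin
    (x ∧ y ∨ z) ∧ y            ≡⟨ ∧-distribʳ-∨ (x ∧ y) z y ⟩
    (x ∧ y) ∧ y ∨ z ∧ y        ≡⟨ cong (_∨ z ∧ y) (∧-absorbʳ x y) ⟩
    x ∧ y ∨ z ∧ y              ≡⟨ sym (∧-distribʳ-∨ x z y) ⟩
    (x ∨ z) ∧ y                ∎

  ∨-∧𝟘 : ∀ x y → (x ∨ y) ∧ 𝟘 ≡ (x ∧ 𝟘) ∧ y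
  ∨-∧𝟘 x y = begin
    (x ∨ y) ∧ 𝟘                      ≡⟨ cong (_∧ 𝟘) (∨-comm x y) ⟩
    (y ∨ x) ∧ 𝟘                      ≡⟨ sym (unit-∧𝟘 y x) ⟩
    𝟙[ y ] ∧ (x ∧ 𝟘)                 ≡⟨ sym (∨∧-unit y (x ∧ 𝟘)) ⟩
    (y ∨ x ∧ 𝟘) ∧ (x ∧ 𝟘)            ≡⟨ cong (_∧ (x ∧ 𝟘)) (∨-comm y (x ∧ 𝟘)) ⟩
    (x ∧ 𝟘 ∨ y) ∧ (x ∧ 𝟘)            ≡⟨ cong (λ w → (w ∨ y) ∧ (x ∧ 𝟘)) (sym (∧-absorbʳ x 𝟘)) ⟩
    ((x ∧ 𝟘) ∧ 𝟘 ∨ y) ∧ (x ∧ 𝟘)      ≡⟨ cong (_∧ (x ∧ 𝟘)) (∧𝟘∨-unit (x ∧ 𝟘) y) ⟩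
    (𝟙[ x ∧ 𝟘 ] ∧ y) ∧ (x ∧ 𝟘)       ≡⟨ ∧-unit-absorb y (x ∧ 𝟘) ⟩
    y ∧ (x ∧ 𝟘)                      ≡⟨ ∧-comm y (x ∧ 𝟘) ⟩
    (x ∧ 𝟘) ∧ y                      ∎

  unit-∧-∧𝟘 : ∀ x y → (𝟙[ x ] ∧ y) ∧ 𝟘 ≡ (x ∧ 𝟘) ∧ y
  unit-∧-∧𝟘 x y = begin
    (𝟙[ x ] ∧ y) ∧ 𝟘           ≡⟨ cong (_∧ 𝟘) (sym (∧𝟘∨-unit x y)) ⟩
    (x ∧ 𝟘 ∨ y) ∧ 𝟘            ≡⟨ ∧∨-absorb x 𝟘 y ⟩
    (x ∨ y) ∧ 𝟘                ≡⟨ ∨-∧𝟘 x y ⟩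
    (x ∧ 𝟘) ∧ y                ∎

  ∧-∧𝟘-absorb : ∀ x y → (x ∧ y) ∧ (y ∧ 𝟘) ≡ (x ∧ y) ∧ 𝟘
  ∧-∧𝟘-absorb x y = begin
    (x ∧ y) ∧ (y ∧ 𝟘)          ≡⟨ ∧-comm (x ∧ y) (y ∧ 𝟘) ⟩
    (y ∧ 𝟘) ∧ (x ∧ y)          ≡⟨ sym (unit-∧-∧𝟘 y (x ∧ y)) ⟩
    (𝟙[ y ] ∧ (x ∧ y)) ∧ 𝟘     ≡⟨ cong (_∧ 𝟘) (unit-∧-absorb x y) ⟩
    (x ∧ y) ∧ 𝟘                ∎

  ∧𝟘-∧-absorb : ∀ x y → (x ∧ 𝟘) ∧ (x ∧ y) ≡ (x ∨ y) ∧ 𝟘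
  ∧𝟘-∧-absorb x y = begin
    (x ∧ 𝟘) ∧ (x ∧ y)          ≡⟨ sym (∨-∧𝟘 x (x ∧ y)) ⟩
    (x ∨ x ∧ y) ∧ 𝟘            ≡⟨ cong (_∧ 𝟘) (trans (∨-comm x (x ∧ y)) (cong (_∨ x) (∧-comm x y))) ⟩
    (y ∧ x ∨ x) ∧ 𝟘            ≡⟨ cong (_∧ 𝟘) (∧∨-unit y x) ⟩
    (𝟙[ y ] ∧ x) ∧ 𝟘           ≡⟨ unit-∧-∧𝟘 y x ⟩
    (y ∧ 𝟘) ∧ x                ≡⟨ sym (∨-∧𝟘 y x) ⟩
    (y ∨ x) ∧ 𝟘                ≡⟨ cong (_∧ 𝟘) (∨-comm y x) ⟩
    (x ∨ y) ∧ 𝟘                ∎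

  ∧-∧𝟘≡∨-∧𝟘 : ∀ x y → (x ∧ y) ∧ 𝟘 ≡ (x ∨ y) ∧ 𝟘
  ∧-∧𝟘≡∨-∧𝟘 x y = begin
    (x ∧ y) ∧ 𝟘                ≡⟨ cong (_∧ 𝟘) (∧-comm x y) ⟩
    (y ∧ x) ∧ 𝟘                ≡⟨ sym (∧-∧𝟘-absorb y x) ⟩
    (y ∧ x) ∧ (x ∧ 𝟘)          ≡⟨ ∧-comm (y ∧ x) (x ∧ 𝟘) ⟩
    (x ∧ 𝟘) ∧ (y ∧ x)          ≡⟨ cong ((x ∧ 𝟘) ∧_) (∧-comm y x) ⟩
    (x ∧ 𝟘) ∧ (x ∧ y)          ≡⟨ ∧𝟘-∧-absorb x y ⟩
    (x ∨ y) ∧ 𝟘                ∎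

  unit-∨≡unit-∧ : ∀ x y → 𝟙[ x ∨ y ] ≡ 𝟙[ x ∧ y ]
  unit-∨≡unit-∧ x y = ¬-injective (begin
    ¬ 𝟙[ x ∨ y ]               ≡⟨ ¬-∨ 𝟙 (x ∨ y) ⟩
    ¬ 𝟙 ∧ ¬ (x ∨ y)            ≡⟨ ∧-comm (¬ 𝟙) (¬ (x ∨ y)) ⟩
    ¬ (x ∨ y) ∧ ¬ 𝟙            ≡⟨ cong₂ _∧_ (¬-∨ x y) ¬𝟙 ⟩
    (¬ x ∧ ¬ y) ∧ 𝟘            ≡⟨ ∧-∧𝟘≡∨-∧𝟘 (¬ x) (¬ y) ⟩
    (¬ x ∨ ¬ y) ∧ 𝟘            ≡⟨ cong₂ _∧_ (sym (¬-∧ x y)) (sym ¬𝟙) ⟩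
    ¬ (x ∧ y) ∧ ¬ 𝟙            ≡⟨ ∧-comm (¬ (x ∧ y)) (¬ 𝟙) ⟩
    ¬ 𝟙 ∧ ¬ (x ∧ y)            ≡⟨ sym (¬-∨ 𝟙 (x ∧ y)) ⟩
    ¬ 𝟙[ x ∧ y ]               ∎)

  ∨-∧-absorb : ∀ x y z → (x ∨ y) ∧ (z ∧ y) ≡ 𝟙[ x ] ∧ (z ∧ y)
  ∨-∧-absorb x y z = begin
    (x ∨ y) ∧ (z ∧ y)              ≡⟨ ∧-distribʳ-∨ x y (z ∧ y) ⟩
    x ∧ (z ∧ y) ∨ y ∧ (z ∧ y)      ≡⟨ cong (x ∧ (z ∧ y) ∨_) (trans (∧-comm y (z ∧ y)) (∧-absorbʳ z y)) ⟩
    x ∧ (z ∧ y) ∨ z ∧ y            ≡⟨ ∧∨-unit x (z ∧ y) ⟩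
    𝟙[ x ] ∧ (z ∧ y)               ∎

  unit-∧-shift : ∀ x y z → 𝟙[ x ∧ z ] ∧ (y ∧ z) ≡ (𝟙[ x ] ∧ y) ∧ z
  unit-∧-shift x y z = begin
    𝟙[ x ∧ z ] ∧ (y ∧ z)           ≡⟨ sym (∧𝟘∨-unit (x ∧ z) (y ∧ z)) ⟩
    (x ∧ z) ∧ 𝟘 ∨ y ∧ z            ≡⟨ cong (_∨ y ∧ z) (trans (∧-∧𝟘≡∨-∧𝟘 x z) (∨-∧𝟘 x z)) ⟩
    (x ∧ 𝟘) ∧ z ∨ y ∧ z            ≡⟨ sym (∧-distribʳ-∨ (x ∧ 𝟘) y z) ⟩
    (x ∧ 𝟘 ∨ y) ∧ z                ≡⟨ cong (_∧ z) (∧𝟘∨-unit x y) ⟩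
    (𝟙[ x ] ∧ y) ∧ z               ∎

  unit-∧-assoc : ∀ x y z → (𝟙[ x ] ∧ y) ∧ z ≡ 𝟙[ x ] ∧ (y ∧ z)
  unit-∧-assoc x y z = begin
    (𝟙[ x ] ∧ y) ∧ z               ≡⟨ sym (unit-∧-shift x y z) ⟩
    𝟙[ x ∧ z ] ∧ (y ∧ z)           ≡⟨ cong (_∧ (y ∧ z)) (sym (unit-∨≡unit-∧ x z)) ⟩
    𝟙[ x ∨ z ] ∧ (y ∧ z)           ≡⟨ sym (∨-∧-absorb (x ∨ z) z y) ⟩
    ((x ∨ z) ∨ z) ∧ (y ∧ z)        ≡⟨ cong (_∧ (y ∧ z)) (∨-absorbʳ x z) ⟩
    (x ∨ z) ∧ (y ∧ z)              ≡⟨ ∨-∧-absorb x z y ⟩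
    𝟙[ x ] ∧ (y ∧ z)               ∎

  -- The main step: if e = a ∧ ¬ a is fixed by meeting with 𝟘, then ¬ e is
  -- the unit of e, and meets with ¬ e associate in the form needed.
  complement-∧-assoc : ∀ a → 𝟘 ∧ (a ∧ ¬ a) ≡ a ∧ ¬ a →
                       ∀ b c → ¬ (a ∧ ¬ a) ∧ (b ∧ c) ≡ ((a ∧ ¬ a) ∨ b) ∧ c
  complement-∧-assoc a 𝟘∧e≡e b c = begin
    ¬ e ∧ (b ∧ c)                  ≡⟨ cong (_∧ (b ∧ c)) ¬e≡unit ⟩
    𝟙[ e ] ∧ (b ∧ c)               ≡⟨ sym (unit-∧-assoc e b c) ⟩
    (𝟙[ e ] ∧ b) ∧ c               ≡⟨ cong (_∧ c) (sym e∨b≡unit) ⟩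
    (e ∨ b) ∧ c                    ∎
    where
    e : Carrier
    e = a ∧ ¬ a

    -- ¬ e and e have the same unit, being (up to order) a join and a meet of a, ¬ a.
    unit-¬e : 𝟙[ ¬ e ] ≡ 𝟙[ e ]
    unit-¬e = begin
      𝟙[ ¬ e ]                     ≡⟨ cong 𝟙[_] (trans (¬-∧ a (¬ a)) (cong (¬ a ∨_) (¬-involutive a))) ⟩
      𝟙[ ¬ a ∨ a ]                 ≡⟨ unit-∨≡unit-∧ (¬ a) a ⟩
      𝟙[ ¬ a ∧ a ]                 ≡⟨ cong 𝟙[_] (∧-comm (¬ a) a) ⟩
      𝟙[ e ]                       ∎

    ¬e≡unit : ¬ e ≡ 𝟙[ e ]
    ¬e≡unit = begin
      ¬ e                          ≡⟨ cong ¬_ (sym 𝟘∧e≡e) ⟩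
      ¬ (𝟘 ∧ e)                    ≡⟨ ¬-∧ 𝟘 e ⟩
      𝟙[ ¬ e ]                     ≡⟨ unit-¬e ⟩
      𝟙[ e ]                       ∎

    e∨b≡unit : e ∨ b ≡ 𝟙[ e ] ∧ b
    e∨b≡unit = begin
      e ∨ b                        ≡⟨ cong (_∨ b) (trans (sym 𝟘∧e≡e) (∧-comm 𝟘 e)) ⟩
      e ∧ 𝟘 ∨ b                    ≡⟨ ∧𝟘∨-unit e b ⟩
      𝟙[ e ] ∧ b                   ∎

module SymmetricIZroupoid {a : Level} (A : Zroupoid a) (S : InS A) where
  open Zroupoid A
  open InS S
  open IsIZroupoid isIZroupoid using (I)
  open ≡-Reasoning

  -- Binding between ≡ and →, so that x ∧ y ′ means x ∧ (y ′).
  infix 4.6 _∧_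
  infix 4.3 _∨_
  _∧_ : Carrier → Carrier → Carrier
  x ∧ y = (x ⇒ y ′) ′

  _∨_ : Carrier → Carrier → Carrier
  x ∨ y = (x ′ ∧ y ′) ′

  ⇒′-swap : ∀ x z → z ⇒ x ′ ≡ x ⇒ z ′
  ⇒′-swap x z = trans (sym (involution (z ⇒ x ′))) (trans (cong _′ (sym′ z x)) (involution (x ⇒ z ′)))

  ∧-identityʳ : ∀ x → x ∧ 𝟎 ′ ≡ x
  ∧-identityʳ x = trans (cong (λ w → (x ⇒ w) ′) (involution 𝟎)) (involution x)

  -- Identity (I) is distributivity: both sides reduce to (x → z′) → (y → z′)′.
  ∧-distribʳ-∨ : ∀ x y z → (x ∨ y) ∧ z ≡ (x ∧ z) ∨ (y ∧ z)
  ∧-distribʳ-∨ x y z = begin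
    ((((x ′ ⇒ y ′ ′) ′) ′) ⇒ z ′) ′     ≡⟨ cong (λ w → (w ⇒ z ′) ′) (trans (involution _) (cong (x ′ ⇒_) (involution y))) ⟩
    ((x ′ ⇒ y) ⇒ z ′) ′                  ≡⟨ cong _′ (I (x ′) y (z ′)) ⟩
    (((z ′ ′ ⇒ x ′) ⇒ (y ⇒ z ′) ′) ′) ′  ≡⟨ involution _ ⟩
    (z ′ ′ ⇒ x ′) ⇒ (y ⇒ z ′) ′          ≡⟨ cong (λ w → (w ⇒ x ′) ⇒ (y ⇒ z ′) ′) (involution z) ⟩
    (z ⇒ x ′) ⇒ (y ⇒ z ′) ′              ≡⟨ cong (_⇒ (y ⇒ z ′) ′) (⇒′-swap x z) ⟩
    (x ⇒ z ′) ⇒ (y ⇒ z ′) ′              ≡⟨ sym (cong₂ _⇒_ (involution _) (involution _)) ⟩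
    ((x ⇒ z ′) ′) ′ ⇒ ((y ⇒ z ′) ′) ′ ′  ≡⟨ sym (involution _) ⟩
    ((((x ⇒ z ′) ′) ′ ⇒ ((y ⇒ z ′) ′) ′ ′) ′) ′ ∎

  deMorganGroupoid : DeMorganGroupoid a
  deMorganGroupoid = record
    { Carrier      = Carrier
    ; _∧_          = _∧_
    ; ¬_           = _′
    ; 𝟘            = 𝟎
    ; ¬-involutive = involution
    ; ∧-comm       = sym′
    ; ∧-identityʳ  = ∧-identityʳ
    ; ∧-distribʳ-∨ = ∧-distribʳ-∨
    }

  open DeMorganGroupoidProperties deMorganGroupoid public using (¬-injective; complement-∧-assoc)

  ⇒-as-∧ : ∀ x y → x ⇒ y ≡ (x ∧ y ′) ′
  ⇒-as-∧ x y = sym (trans (involution _) (cong (x ⇒_) (involution y)))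

  𝟎∧-complement : ∀ x → 𝟎 ⇒ (x ⇒ x) ≡ x ⇒ x → 𝟎 ∧ (x ∧ x ′) ≡ x ∧ x ′
  𝟎∧-complement x h = ¬-injective (begin
    (𝟎 ∧ (x ∧ x ′)) ′               ≡⟨ cong (λ w → (𝟎 ∧ w) ′) (sym (involution (x ∧ x ′))) ⟩
    (𝟎 ∧ (x ∧ x ′) ′ ′) ′           ≡⟨ sym (⇒-as-∧ 𝟎 ((x ∧ x ′) ′)) ⟩
    𝟎 ⇒ (x ∧ x ′) ′                 ≡⟨ cong (𝟎 ⇒_) (sym (⇒-as-∧ x x)) ⟩
    𝟎 ⇒ (x ⇒ x)                     ≡⟨ h ⟩
    x ⇒ x                           ≡⟨ ⇒-as-∧ x x ⟩
    (x ∧ x ′) ′                     ∎)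

-- Lemma 3.4: with e = x ∧ x′, both sides are ¬ of  ¬ e ∧ (y ∧ z′)  and
-- (e ∨ y) ∧ z′  respectively, which agree by complement-∧-assoc.
lemma3p4 : {a : Level} (A : Zroupoid a) → InS A
    → (∀ x → Zroupoid._⇒_ A (Zroupoid.𝟎 A) (Zroupoid._⇒_ A x x) ≡ Zroupoid._⇒_ A x x)
    → ∀ x y z → Zroupoid._⇒_ A (Zroupoid._⇒_ A x x) (Zroupoid._⇒_ A y z)
    ≡ Zroupoid._⇒_ A (Zroupoid._⇒_ A (Zroupoid._⇒_ A x x) y) z
lemma3p4 A S h x y z = begin
    (x ⇒ x) ⇒ (y ⇒ z)                   ≡⟨ ⇒-as-∧ (x ⇒ x) (y ⇒ z) ⟩
    ((x ⇒ x) ∧ (y ⇒ z) ′) ′             ≡⟨ cong₂ (λ u v → (u ∧ v) ′) (⇒-as-∧ x x) negated-implication ⟩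
    ((x ∧ x ′) ′ ∧ (y ∧ z ′)) ′         ≡⟨ cong _′ (complement-∧-assoc x (𝟎∧-complement x (h x)) y (z ′)) ⟩
    (((x ∧ x ′) ∨ y) ∧ z ′) ′           ≡⟨ cong (λ u → ((u ∧ y ′) ′ ∧ z ′) ′) (sym (⇒-as-∧ x x)) ⟩
    (((x ⇒ x) ∧ y ′) ′ ∧ z ′) ′         ≡⟨ cong (λ u → (u ∧ z ′) ′) (sym (⇒-as-∧ (x ⇒ x) y)) ⟩
    (((x ⇒ x) ⇒ y) ∧ z ′) ′             ≡⟨ sym (⇒-as-∧ ((x ⇒ x) ⇒ y) z) ⟩
    ((x ⇒ x) ⇒ y) ⇒ z                   ∎
  where
  open Zroupoid A
  open InS S using (involution)
  open SymmetricIZroupoid A S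
  open ≡-Reasoning

  negated-implication : (y ⇒ z) ′ ≡ (y ∧ z ′)
  negated-implication = trans (cong _′ (⇒-as-∧ y z)) (involution (y ∧ z ′))
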